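{- Let $1\le q\le p$ be integers, $\gamma$ the largest root of $x^2-px-q$, $m\ge0$, and $\Gamma^R_m=\{0=n_0<n_1<\dots<n_{G_m-1}\}$. For $0\le l<G_m$, the elementary $m$-interval $I=[\overline{n_l}/\gamma^m,\overline{n_{l+1}}/\gamma^m)$ has length $\gamma^{ -m}$ if the last base-$(p+1)$ digit of $n_l$ is strictly less than $p$, and length $q\gamma^{ -m-1}$ if that last digit equals $p$.
   Context: For $m\ge0$, $\Gamma^R_m$ denotes the set of integers $0\le n<(p+1)^m$ whose base-$(p+1)$ expansion $n=\sum_{j=0}^{m-1}d_j(p+1)^j$ satisfies: whenever $d_j=p$ with $j\ge1$, then $d_{j-1}<q$. Its elements listed increasingly are $n_0<\dots<n_{G_m-1}$, where $G_m=|\Gamma^R_m|$. For such $n$ put $\overline n:=\sum_jd_j\gamma^j$, with the convention $\overline{n_{G_m}}:=\gamma^m$, so that the elementary $m$-intervals $[\overline{n_l}/\gamma^m,\overline{n_{l+1}}/\gamma^m)$, $0\le l<G_m$, partition $[0,1)$. -}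

module Defs where

open import Data.Nat using (ℕ; zero; suc; _+_; _*_; _^_; _%_; _/_; _≡ᵇ_; _<ᵇ_)
open import Data.Bool using (Bool; true; false; not; _∧_; _∨_)
open import Data.Product using (_×_; _,_)
open import Data.Maybe using (Maybe; just; nothing)
open import Data.List using (List; []; _∷_; filterᵇ; upTo; length)

-- Elements of ℕ[γ] ⊂ ℝ, where γ is the largest root of x² - p x - q.
-- The pair (a , b) represents a + b γ.  Since 1 ≤ q ≤ p, the
-- discriminant p² + 4q lies strictly between p² and (p+2)² and differs
-- from (p+1)², so γ is irrational and this representation is unique:
-- equality of pairs is equality of the real numbers.
ZG : Set
ZG = ℕ × ℕ

_⊕_ : ZG → ZG → ZG
(a , b) ⊕ (c , d) = (a + c , b + d)

scale : ℕ → ZG → ZG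
scale k (a , b) = (k * a , k * b)

module _ (p q : ℕ) where

  -- multiplication by γ, using γ² = p γ + q
  mulγ : ZG → ZG
  mulγ (a , b) = (b * q , a + b * p)

  γpow : ℕ → ZG
  γpow zero    = (1 , 0)
  γpow (suc j) = mulγ (γpow j)

  digit : ℕ → ℕ → ℕ
  digit zero    n = n % suc p
  digit (suc j) n = digit j (n / suc p)

  adm : ℕ → ℕ → Bool
  adm zero          n = true
  adm (suc zero)    n = true
  adm (suc (suc k)) n =
    (not (digit (suc k) n ≡ᵇ p) ∨ (digit k n <ᵇ q)) ∧ adm (suc k) n

  GammaR : ℕ → List ℕ
  GammaR m = filterᵇ (adm m) (upTo (suc p ^ m))

  G : ℕ → ℕ
  G m = length (GammaR m)

  bar : ℕ → ℕ → ZG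
  bar zero    n = (0 , 0)
  bar (suc m) n = scale (digit m n) (γpow m) ⊕ bar m n

  index : List ℕ → ℕ → Maybe ℕ
  index []       k       = nothing
  index (x ∷ xs) zero    = just x
  index (x ∷ xs) (suc k) = index xs k

  -- the k-th point n̄_k (γ^m-scaled left endpoint), with the convention
  -- n̄_{G_m} := γ^m
  endpt : ℕ → ℕ → ZG
  endpt m k with index (GammaR m) k
  ... | just n  = bar m n
  ... | nothing = γpow m

  nth : (m : ℕ) → ℕ → ℕ
  nth m k with index (GammaR m) k
  ... | just n  = n
  ... | nothing = 0

{-# OPTIONS --safe #-}
-- Γ^R_{m+1} arises from Γ^R_m by appending a last digit: the children of n ∈ Γ^R_m are
-- n(p+1) + i for i ≤ p, or only for i < q when d₀(n) = p, and listing the children of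
-- n₀ < n₁ < … in turn lists Γ^R_{m+1} increasingly.  As the bar of n(p+1) + i is
-- i + γ n̄, consecutive children are 1 apart, and if [n̄, e) is the (γ^m-scaled)
-- interval of n, the last child ends at γ e.  By induction on m, when d₀(n) = p we
-- have γ e = γ n̄ + q, so the last child q − 1 + γ n̄ also gets length 1; when d₀(n) < p
-- we have e = n̄ + 1, and the last child p + γ n̄ gets length γ − p = q/γ, because
-- γ² = pγ + q.
module Submission where

open import Defs
open import Data.Bool using (Bool; true; false; not; _∧_; _∨_; if_then_else_; T)
open import Data.Bool.Properties using (T-≡; ∧-assoc; ∧-identityʳ)
open import Data.Empty using (⊥-elim)
open import Data.List using (List; []; _∷_; _++_; concat; concatMap; map; head; length; applyUpTo; upTo; filterᵇ)
open import Data.List.Properties using (filter-++; map-applyUpTo; map-upTo)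
open import Data.Maybe using (just; nothing; maybe′)
import Data.Maybe as Maybe
open import Data.Maybe.Properties using (just-injective)
open import Data.Nat using (ℕ; zero; suc; _+_; _*_; _^_; _/_; _≤_; _<_; _≡ᵇ_; _<ᵇ_; z≤n; s≤s; s≤s⁻¹; z<s; s<s)
open import Data.Nat.Properties
open import Data.Nat.DivMod using (%-remove-+ˡ; m<n⇒m%n≡m; m%n<n; +-distrib-/-∣ˡ; m*n/n≡m; m<n⇒m/n≡0)
open import Data.Nat.Divisibility using (n∣m*n)
open import Data.Nat.Tactic.RingSolver using (solve-∀)
open import Algebra.Properties.CommutativeSemigroup +-commutativeSemigroup using (x∙yz≈y∙xz)
open import Data.Product using (_×_; _,_; ∃)
open import Function using (_∘_; id; Equivalence)
open import Relation.Nullary.Decidable using (T?)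
open import Relation.Binary.PropositionalEquality

private variable
  A B C D : Set

applyUpTo-cong : ∀ {f g : ℕ → A} n → (∀ {i} → i < n → f i ≡ g i) → applyUpTo f n ≡ applyUpTo g n
applyUpTo-cong zero    f≡g = refl
applyUpTo-cong (suc n) f≡g = cong₂ _∷_ (f≡g z<s) (applyUpTo-cong n (f≡g ∘ s<s))

applyUpTo-+ : ∀ (f : ℕ → A) m n → applyUpTo f (m + n) ≡ applyUpTo f m ++ applyUpTo (f ∘ (m +_)) n
applyUpTo-+ f zero    n = refl
applyUpTo-+ f (suc m) n = cong (f 0 ∷_) (applyUpTo-+ (f ∘ suc) m n)

applyUpTo-* : ∀ (f : ℕ → A) m n →
  applyUpTo f (m * n) ≡ concat (applyUpTo (λ x → applyUpTo (λ i → f (x * n + i)) n) m)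
applyUpTo-* f zero    n = refl
applyUpTo-* f (suc m) n = begin
  applyUpTo f (n + m * n)
    ≡⟨ applyUpTo-+ f n (m * n) ⟩
  applyUpTo f n ++ applyUpTo (f ∘ (n +_)) (m * n)
    ≡⟨ cong (applyUpTo f n ++_) (applyUpTo-* (f ∘ (n +_)) m n) ⟩
  applyUpTo f n ++ concat (applyUpTo (λ x → applyUpTo (λ i → f (n + (x * n + i))) n) m)
    ≡⟨ cong (λ rows → applyUpTo f n ++ concat rows) (applyUpTo-cong m λ {x} _ →
         applyUpTo-cong n λ {i} _ → cong f (sym (+-assoc n (x * n) i))) ⟩
  applyUpTo f n ++ concat (applyUpTo (λ x → applyUpTo (λ i → f (n + x * n + i)) n) m)
    ∎
  where open ≡-Reasoning

filterᵇ-concat : ∀ (P : A → Bool) xss → filterᵇ P (concat xss) ≡ concat (map (filterᵇ P) xss)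
filterᵇ-concat P []         = refl
filterᵇ-concat P (xs ∷ xss) =
  trans (filter-++ (T? ∘ P) xs (concat xss)) (cong (filterᵇ P xs ++_) (filterᵇ-concat P xss))

filterᵇ-applyUpTo-prefix : ∀ (P : A → Bool) (f : ℕ → A) {n k} → k ≤ n →
  (∀ {i} → i < n → P (f i) ≡ (i <ᵇ k)) → filterᵇ P (applyUpTo f n) ≡ applyUpTo f k
filterᵇ-applyUpTo-prefix P f {zero}  z≤n  _ = refl
filterᵇ-applyUpTo-prefix P f {suc n} {zero} z≤n P≡ rewrite P≡ z<s =
  filterᵇ-applyUpTo-prefix P (f ∘ suc) z≤n (P≡ ∘ s<s)
filterᵇ-applyUpTo-prefix P f {suc n} {suc k} k≤n P≡ rewrite P≡ z<s =
  cong (f 0 ∷_) (filterᵇ-applyUpTo-prefix P (f ∘ suc) (s≤s⁻¹ k≤n) (P≡ ∘ s<s))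

concatMap-filterᵇ : ∀ (P : A → Bool) (f : A → List B) xs →
  concatMap f (filterᵇ P xs) ≡ concatMap (λ x → if P x then f x else []) xs
concatMap-filterᵇ P f []       = refl
concatMap-filterᵇ P f (x ∷ xs) with P x
... | true  = cong (f x ++_) (concatMap-filterᵇ P f xs)
... | false = concatMap-filterᵇ P f xs

⊕-identityˡ : ∀ X → (0 , 0) ⊕ X ≡ X
⊕-identityˡ (a , b) = refl

X⊕[Y⊕Z]≡Y⊕[X⊕Z] : ∀ X Y Z → X ⊕ (Y ⊕ Z) ≡ Y ⊕ (X ⊕ Z)
X⊕[Y⊕Z]≡Y⊕[X⊕Z] (a , b) (c , d) (e , f) = cong₂ _,_ (x∙yz≈y∙xz a c e) (x∙yz≈y∙xz b d f)

[1+i]⊕X≡[i⊕X]⊕1 : ∀ i X → (suc i , 0) ⊕ X ≡ ((i , 0) ⊕ X) ⊕ (1 , 0)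
[1+i]⊕X≡[i⊕X]⊕1 i (a , b) = cong₂ _,_ (+-comm 1 (i + a)) (sym (+-identityʳ b))

X⊕[1+k]≡[k⊕X]⊕1 : ∀ k X → X ⊕ (suc k , 0) ≡ ((k , 0) ⊕ X) ⊕ (1 , 0)
X⊕[1+k]≡[k⊕X]⊕1 k (a , b) = cong₂ _,_ (trans (+-comm a (suc k)) (+-comm 1 (k + a))) refl

γ[kX⊕Y]≡kγX⊕γY : ∀ p q k X Y → mulγ p q (scale k X ⊕ Y) ≡ scale k (mulγ p q X) ⊕ mulγ p q Y
γ[kX⊕Y]≡kγX⊕γY p q k (a , b) (c , d) = cong₂ _,_ (first p q k a b c d) (second p q k a b c d)
  where
  first : ∀ p q k a b c d → (k * b + d) * q ≡ k * (b * q) + d * q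
  first = solve-∀
  second : ∀ p q k a b c d → (k * a + c) + (k * b + d) * p ≡ k * (a + b * p) + (c + d * p)
  second = solve-∀

γ[γ[X⊕1]]≡γ[p⊕γX]⊕q : ∀ p q X →
  mulγ p q (mulγ p q (X ⊕ (1 , 0))) ≡ mulγ p q ((p , 0) ⊕ mulγ p q X) ⊕ (q , 0)
γ[γ[X⊕1]]≡γ[p⊕γX]⊕q p q (a , b) = cong₂ _,_ (first p q a b) (second p q a b)
  where
  first : ∀ p q a b → (a + 1 + (b + 0) * p) * q ≡ (a + b * p) * q + q
  first = solve-∀
  second : ∀ p q a b → (b + 0) * q + (a + 1 + (b + 0) * p) * p ≡ p + b * q + (a + b * p) * p + 0
  second = solve-∀

data Chain (f : A → B) (R : A → B → Set) (e : B) : List A → Set where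
  []  : Chain f R e []
  _∷_ : ∀ {x xs} → R x (maybe′ f e (head xs)) → Chain f R e xs → Chain f R e (x ∷ xs)

Chain-++ : ∀ {f : A → B} {R e xs ys} →
  Chain f R (maybe′ f e (head ys)) xs → Chain f R e ys → Chain f R e (xs ++ ys)
Chain-++ []               c = c
Chain-++ (r ∷ [])         c = r ∷ c
Chain-++ (r ∷ rs@(_ ∷ _)) c = r ∷ Chain-++ rs c

Chain-applyUpTo : ∀ {f : A → B} {R e} (g : ℕ → A) n →
  (∀ {i} → i < n → R (g i) (f (g (suc i)))) → R (g n) e → Chain f R e (applyUpTo g (suc n))
Chain-applyUpTo g zero    links last = last ∷ []
Chain-applyUpTo g (suc n) links last = links z<s ∷ Chain-applyUpTo (g ∘ suc) n (links ∘ s<s) last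

Chain-concatMap : ∀ {f : A → B} {R : A → B → Set} {f′ : C → D} {R′ : C → D → Set} {e xs}
  (g : A → List C) (h : B → D) →
  (∀ x → Maybe.map f′ (head (g x)) ≡ just (h (f x))) →
  (∀ {x b} → R x b → Chain f′ R′ (h b) (g x)) →
  Chain f R e xs → Chain f′ R′ (h e) (concatMap g xs)
Chain-concatMap {f = f} {f′ = f′} {R′ = R′} {e = e} g h first refine = go
  where
  head-concatMap : ∀ xs → maybe′ f′ (h e) (head (concatMap g xs)) ≡ h (maybe′ f e (head xs))
  head-concatMap []       = refl
  head-concatMap (x ∷ xs) with g x | first x
  ... | _ ∷ _ | first≡ = just-injective first≡

  go : ∀ {xs} → Chain _ _ e xs → Chain f′ R′ (h e) (concatMap g xs)
  go []                  = []
  go (_∷_ {x} {xs} r rs) =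
    Chain-++ (subst (λ b → Chain f′ R′ b (g x)) (sym (head-concatMap xs)) (refine r)) (go rs)

module _ (p′ q′ : ℕ) (q≤p : suc q′ ≤ suc p′) where

  p q base : ℕ
  p    = suc p′
  q    = suc q′
  base = suc p

  q′<p : q′ < p
  q′<p = s≤s (s≤s⁻¹ q≤p)

  d₀ : ℕ → ℕ
  d₀ = digit p q 0

  d₀[x*base+i]≡i : ∀ x {i} → i < base → d₀ (x * base + i) ≡ i
  d₀[x*base+i]≡i x {i} i<base = trans (%-remove-+ˡ i (n∣m*n x)) (m<n⇒m%n≡m i<base)

  [x*base+i]/base≡x : ∀ x {i} → i < base → (x * base + i) / base ≡ x
  [x*base+i]/base≡x x {i} i<base = begin
    (x * base + i) / base        ≡⟨ +-distrib-/-∣ˡ i (n∣m*n x) ⟩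
    x * base / base + i / base   ≡⟨ cong₂ _+_ (m*n/n≡m x base) (m<n⇒m/n≡0 i<base) ⟩
    x + 0                        ≡⟨ +-identityʳ x ⟩
    x                            ∎
    where open ≡-Reasoning

  bar-suc : ∀ m n → bar p q (suc m) n ≡ (d₀ n , 0) ⊕ mulγ p q (bar p q m (n / base))
  bar-suc zero    n =
    cong₂ _,_ (cong (_+ 0) (*-identityʳ (d₀ n))) (trans (+-identityʳ _) (*-zeroʳ (d₀ n)))
  bar-suc (suc m) n = begin
    scale k (mulγ p q g) ⊕ bar p q (suc m) n
      ≡⟨ cong (scale k (mulγ p q g) ⊕_) (bar-suc m n) ⟩
    scale k (mulγ p q g) ⊕ ((d₀ n , 0) ⊕ mulγ p q X)
      ≡⟨ X⊕[Y⊕Z]≡Y⊕[X⊕Z] (scale k (mulγ p q g)) (d₀ n , 0) (mulγ p q X) ⟩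
    (d₀ n , 0) ⊕ (scale k (mulγ p q g) ⊕ mulγ p q X)
      ≡⟨ cong ((d₀ n , 0) ⊕_) (sym (γ[kX⊕Y]≡kγX⊕γY p q k g X)) ⟩
    (d₀ n , 0) ⊕ mulγ p q (scale k g ⊕ X)
      ∎
    where
    open ≡-Reasoning
    k : ℕ
    k = digit p q m (n / base)
    g X : ZG
    g = γpow p q m
    X = bar p q m (n / base)

  bar-child : ∀ m x {i} → i < base →
    bar p q (suc m) (x * base + i) ≡ (i , 0) ⊕ mulγ p q (bar p q m x)
  bar-child m x i<base = trans (bar-suc m _)
    (cong₂ (λ d y → (d , 0) ⊕ mulγ p q (bar p q m y))
           (d₀[x*base+i]≡i x i<base) ([x*base+i]/base≡x x i<base))

  adm-suc-suc : ∀ k n →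
    adm p q (suc (suc k)) n ≡ adm p q (suc k) (n / base) ∧ (not (d₀ (n / base) ≡ᵇ p) ∨ (d₀ n <ᵇ q))
  adm-suc-suc zero    n = ∧-identityʳ _
  adm-suc-suc (suc k) n = trans (cong (newest ∧_) (adm-suc-suc k n)) (sym (∧-assoc newest _ _))
    where
    newest : Bool
    newest = not (digit p q (suc k) (n / base) ≡ᵇ p) ∨ (digit p q k (n / base) <ᵇ q)

  adm-child : ∀ m x {i} → x < base ^ m → i < base →
    adm p q (suc m) (x * base + i) ≡ adm p q m x ∧ (not (d₀ x ≡ᵇ p) ∨ (i <ᵇ q))
  adm-child zero    _ (s≤s z≤n) _      = refl
  adm-child (suc k) x _         i<base = trans (adm-suc-suc k _)
    (cong₂ (λ y d → adm p q (suc k) y ∧ (not (d₀ y ≡ᵇ p) ∨ (d <ᵇ q)))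
           ([x*base+i]/base≡x x i<base) (d₀[x*base+i]≡i x i<base))

  maxChildDigit : ℕ → ℕ
  maxChildDigit x = if d₀ x ≡ᵇ p then q′ else p

  children : ℕ → List ℕ
  children x = applyUpTo (λ i → x * base + i) (suc (maxChildDigit x))

  maxChildDigit<base : ∀ x → suc (maxChildDigit x) ≤ base
  maxChildDigit<base x with d₀ x ≡ᵇ p
  ... | true  = m<n⇒m<1+n q′<p
  ... | false = ≤-refl

  childDigit-allowed : ∀ x {i} → i < base →
    (not (d₀ x ≡ᵇ p) ∨ (i <ᵇ q)) ≡ (i <ᵇ suc (maxChildDigit x))
  childDigit-allowed x i<base with d₀ x ≡ᵇ p
  ... | true  = refl
  ... | false = sym (Equivalence.to T-≡ (<⇒<ᵇ i<base))

  filterᵇ-block : ∀ m x → x < base ^ m →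
    filterᵇ (adm p q (suc m)) (applyUpTo (λ i → x * base + i) base)
      ≡ (if adm p q m x then children x else [])
  filterᵇ-block m x x<N with adm p q m x in adm-x
  ... | false = filterᵇ-applyUpTo-prefix (adm p q (suc m)) (λ i → x * base + i) z≤n
    λ i<base → trans (adm-child m x x<N i<base) (cong (_∧ _) adm-x)
  ... | true  = filterᵇ-applyUpTo-prefix (adm p q (suc m)) (λ i → x * base + i) (maxChildDigit<base x)
    λ i<base → trans (adm-child m x x<N i<base) (trans (cong (_∧ _) adm-x) (childDigit-allowed x i<base))

  GammaR-suc : ∀ m → GammaR p q (suc m) ≡ concatMap children (GammaR p q m)
  GammaR-suc m = begin
    filterᵇ admissible (upTo (base * N))
      ≡⟨ cong (filterᵇ admissible ∘ upTo) (*-comm base N) ⟩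
    filterᵇ admissible (upTo (N * base))
      ≡⟨ cong (filterᵇ admissible) (applyUpTo-* id N base) ⟩
    filterᵇ admissible (concat (applyUpTo block N))
      ≡⟨ filterᵇ-concat admissible (applyUpTo block N) ⟩
    concat (map (filterᵇ admissible) (applyUpTo block N))
      ≡⟨ cong concat (map-applyUpTo block (filterᵇ admissible) N) ⟩
    concat (applyUpTo (filterᵇ admissible ∘ block) N)
      ≡⟨ cong concat (applyUpTo-cong N (filterᵇ-block m _)) ⟩
    concat (applyUpTo (λ x → if adm p q m x then children x else []) N)
      ≡⟨ cong concat (sym (map-upTo _ N)) ⟩
    concatMap (λ x → if adm p q m x then children x else []) (upTo N)
      ≡⟨ sym (concatMap-filterᵇ (adm p q m) children (upTo N)) ⟩
    concatMap children (GammaR p q m)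
      ∎
    where
    open ≡-Reasoning
    N : ℕ
    N = base ^ m
    admissible : ℕ → Bool
    admissible = adm p q (suc m)
    block : ℕ → List ℕ
    block x = applyUpTo (λ i → x * base + i) base

  Gap : ℕ → ZG → ZG → Set
  Gap d b e = (d < p → e ≡ b ⊕ (1 , 0)) × (d ≡ p → mulγ p q e ≡ mulγ p q b ⊕ (q , 0))

  GapAfter : ℕ → ℕ → ZG → Set
  GapAfter m n = Gap (d₀ n) (bar p q m n)

  GapAfter-child : ∀ m x {i e} → i < base →
    Gap i ((i , 0) ⊕ mulγ p q (bar p q m x)) e → GapAfter (suc m) (x * base + i) e
  GapAfter-child m x {e = e} i<base =
    subst₂ (λ d b → Gap d b e) (sym (d₀[x*base+i]≡i x i<base)) (sym (bar-child m x i<base))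

  GapAfter-sibling : ∀ m x {i} → i < p →
    GapAfter (suc m) (x * base + i) (bar p q (suc m) (x * base + suc i))
  GapAfter-sibling m x {i} i<p = GapAfter-child m x (m<n⇒m<1+n i<p)
    ( (λ _ → trans (bar-child m x (s≤s i<p)) ([1+i]⊕X≡[i⊕X]⊕1 i _))
    , (λ i≡p → ⊥-elim (<-irrefl i≡p i<p)) )

  chain-children : ∀ m {x e} → GapAfter m x e →
    Chain (bar p q (suc m)) (GapAfter (suc m)) (mulγ p q e) (children x)
  chain-children m {x} {e} (gap< , gap≡) with d₀ x ≡ᵇ p in d₀≡ᵇp
  ... | true  = Chain-applyUpTo _ q′ (λ i<q′ → GapAfter-sibling m x (<-trans i<q′ q′<p))
    (GapAfter-child m x (m<n⇒m<1+n q′<p)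
      ( (λ _ → trans (gap≡ d₀≡p) (X⊕[1+k]≡[k⊕X]⊕1 q′ _))
      , (λ q′≡p → ⊥-elim (<-irrefl q′≡p q′<p)) ))
    where
    d₀≡p : d₀ x ≡ p
    d₀≡p = ≡ᵇ⇒≡ (d₀ x) p (Equivalence.from T-≡ d₀≡ᵇp)
  ... | false = Chain-applyUpTo _ p (λ i<p → GapAfter-sibling m x i<p)
    (GapAfter-child m x (n<1+n p)
      ( (λ p<p → ⊥-elim (<-irrefl refl p<p))
      , (λ _ → trans (cong (mulγ p q ∘ mulγ p q) (gap< d₀<p))
                     (γ[γ[X⊕1]]≡γ[p⊕γX]⊕q p q (bar p q m x))) ))
    where
    d₀<p : d₀ x < p
    d₀<p = ≤∧≢⇒< (s≤s⁻¹ (m%n<n x base)) λ d₀≡p → subst T d₀≡ᵇp (≡⇒≡ᵇ (d₀ x) p d₀≡p)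

  chain-GammaR : ∀ m → Chain (bar p q m) (GapAfter m) (γpow p q m) (GammaR p q m)
  chain-GammaR zero    = ((λ _ → refl) , λ ()) ∷ []
  chain-GammaR (suc m) = subst (Chain _ _ _) (sym (GammaR-suc m))
    (Chain-concatMap children (mulγ p q) first-child (chain-children m) (chain-GammaR m))
    where
    first-child : ∀ x →
      Maybe.map (bar p q (suc m)) (head (children x)) ≡ just (mulγ p q (bar p q m x))
    first-child x = cong just (trans (bar-child m x z<s) (⊕-identityˡ _))

  Chain-index : ∀ {f : ℕ → B} {R e xs l} → Chain f R e xs → l < length xs →
    ∃ λ x → index p q xs l ≡ just x × R x (maybe′ f e (index p q xs (suc l)))
  Chain-index {xs = x ∷ []}    {l = zero}  (r ∷ _)  _           = x , refl , r
  Chain-index {xs = x ∷ _ ∷ _} {l = zero}  (r ∷ _)  _           = x , refl , r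
  Chain-index                  {l = suc l} (_ ∷ rs) (s<s l<len) = Chain-index rs l<len

  endpt-index : ∀ m k →
    endpt p q m k ≡ maybe′ (bar p q m) (γpow p q m) (index p q (GammaR p q m) k)
  endpt-index m k with index p q (GammaR p q m) k
  ... | just _  = refl
  ... | nothing = refl

  nth-index : ∀ m k {n} → index p q (GammaR p q m) k ≡ just n → nth p q m k ≡ n
  nth-index m k n-at-k with index p q (GammaR p q m) k
  nth-index m k refl | just _ = refl

  endpt-successor : ∀ m l → l < G p q m →
    Gap (d₀ (nth p q m l)) (endpt p q m l) (endpt p q m (suc l))
  endpt-successor m l l<G with Chain-index (chain-GammaR m) l<G
  ... | x , x-at-l , gap
    rewrite nth-index m l x-at-l | endpt-index m l | endpt-index m (suc l) | x-at-l = gap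

lemma8p8 : (p q : ℕ) → 1 ≤ q → q ≤ p → (m l : ℕ) → l < G p q m →
    (digit p q 0 (nth p q m l) < p →
        endpt p q m (suc l) ≡ endpt p q m l ⊕ (1 , 0))
    × (digit p q 0 (nth p q m l) ≡ p →
        mulγ p q (endpt p q m (suc l)) ≡ mulγ p q (endpt p q m l) ⊕ (q , 0))
lemma8p8 _        zero     ()  _   _ _
lemma8p8 zero     (suc _)  _   ()  _ _
lemma8p8 (suc p′) (suc q′) _   q≤p m l = endpt-successor p′ q′ q≤p m l
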